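{- For every integer $n\ge 0$, \[ \binom{2n}{n}^2\sum_{k}\binom{n}{k}^2\binom{2n+k}{n}=\binom{2n}{n}^2\sum_{k}\binom{n}{k}\binom{n+k}{n}\binom{2n}{k}=\binom{2n}{n}\sum_{k}(-1)^{n+k}\binom{n}{k}\binom{n+k}{n}^2\binom{2n+k}{n}, \] where all sums run over $k=0,\dots,n$.
   Context: $\binom{m}{j}$ is the usual binomial coefficient. -}

module Defs where

open import Data.Nat using (ℕ; zero; suc)
open import Data.Integer using (ℤ; +_; _+_)

sumTo : ℕ → (ℕ → ℤ) → ℤ
sumTo zero    f = f zero
sumTo (suc n) f = sumTo n f + f (suc n)

sign : ℕ → ℤ
sign zero          = + 1
sign (suc zero)    = Data.Integer.-_ (+ 1)
sign (suc (suc m)) = sign m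

-- Each identity comes from expanding one binomial coefficient by Vandermonde's
-- convolution C(a+k,k) = Σᵢ C(a,i) C(k,i), exchanging the two summations and
-- collapsing the new inner sum.  For the first identity, C(n,k) C(k,i) =
-- C(n,i) C(n-i,n-k) turns the inner sum into Σₖ C(2n,k) C(n-i,n-k) = C(3n-i,n),
-- and reversing the order of summation gives the left-hand side.  For the second,
-- C(n+k,n) C(2n+k,n) = C(2n,n) C(2n+k,k) extracts one factor C(2n,n); after
-- expanding C(2n+k,k) and using C(n+k,n) C(k,j) = C(n+k,n+j) C(n+j,j), the inner
-- sum is Σₖ (-1)^(n+k) C(n,k) C(n+k,n+j) = C(n,j).  Both the convolution and this
-- alternating sum follow by induction from Pascal's rule summed against an
-- arbitrary weight.

module Submission where

module Binomial where

  open import Data.Nat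
  open import Data.Nat.Properties
  open import Data.Nat.Combinatorics
  open import Data.Nat.DivMod using (m/n*n≡m)
  open import Data.Nat.Solver using (module +-*-Solver)
  open import Relation.Binary.PropositionalEquality
  open import Relation.Nullary using (yes; no)
  open +-*-Solver

  nCk*[k!*[n∸k]!]≡n! : ∀ {n k} → k ≤ n → (n C k) * (k ! * (n ∸ k) !) ≡ n !
  nCk*[k!*[n∸k]!]≡n! {n} {k} k≤n = begin
      (n C k) * (k ! * (n ∸ k) !)                   ≡⟨ cong (_* (k ! * (n ∸ k) !)) (nCk≡n!/k![n-k]! k≤n) ⟩
      n ! / (k ! * (n ∸ k) !) * (k ! * (n ∸ k) !)   ≡⟨ m/n*n≡m (k![n∸k]!∣n! k≤n) ⟩
      n !                                           ∎
    where
      open ≡-Reasoning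
      instance _ = k !* (n ∸ k) !≢0

  [m+n]Cm≡[m+n]Cn : ∀ m n → (m + n) C m ≡ (m + n) C n
  [m+n]Cm≡[m+n]Cn m n = trans (nCk≡nC[n∸k] (m≤m+n m n)) (cong ((m + n) C_) (m+n∸m≡n m n))

  m∸o∸[n∸o]≡m∸n : ∀ m {n o} → o ≤ n → m ∸ o ∸ (n ∸ o) ≡ m ∸ n
  m∸o∸[n∸o]≡m∸n m {n} {o} o≤n = trans (∸-+-assoc m o (n ∸ o)) (cong (m ∸_) (m+[n∸m]≡n o≤n))

  nCk*kCi≡nCi*[n∸i]C[k∸i] : ∀ {n k i} → i ≤ k → k ≤ n →
                            (n C k) * (k C i) ≡ (n C i) * ((n ∸ i) C (k ∸ i))
  nCk*kCi≡nCi*[n∸i]C[k∸i] {n} {k} {i} i≤k k≤n = *-cancelʳ-≡ _ _ d (begin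
      (n C k) * (k C i) * d
        ≡⟨ solve 5 (λ a b x y z → a :* b :* (x :* (y :* z)) := a :* (b :* (x :* y) :* z))
                   refl (n C k) (k C i) (i !) ((k ∸ i) !) ((n ∸ k) !) ⟩
      (n C k) * ((k C i) * (i ! * (k ∸ i) !) * (n ∸ k) !)
        ≡⟨ cong (λ x → (n C k) * (x * (n ∸ k) !)) (nCk*[k!*[n∸k]!]≡n! i≤k) ⟩
      (n C k) * (k ! * (n ∸ k) !)
        ≡⟨ nCk*[k!*[n∸k]!]≡n! k≤n ⟩
      n !
        ≡⟨ nCk*[k!*[n∸k]!]≡n! (≤-trans i≤k k≤n) ⟨
      (n C i) * (i ! * (n ∸ i) !)
        ≡⟨ cong (λ x → (n C i) * (i ! * x)) (nCk*[k!*[n∸k]!]≡n! (∸-monoˡ-≤ i k≤n)) ⟨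
      (n C i) * (i ! * (((n ∸ i) C (k ∸ i)) * ((k ∸ i) ! * (n ∸ i ∸ (k ∸ i)) !)))
        ≡⟨ cong (λ x → (n C i) * (i ! * (((n ∸ i) C (k ∸ i)) * ((k ∸ i) ! * x !)))) (m∸o∸[n∸o]≡m∸n n i≤k) ⟩
      (n C i) * (i ! * (((n ∸ i) C (k ∸ i)) * ((k ∸ i) ! * (n ∸ k) !)))
        ≡⟨ solve 5 (λ a b x y z → a :* (x :* (b :* (y :* z))) := a :* b :* (x :* (y :* z)))
                   refl (n C i) ((n ∸ i) C (k ∸ i)) (i !) ((k ∸ i) !) ((n ∸ k) !) ⟩
      (n C i) * ((n ∸ i) C (k ∸ i)) * d
        ∎)
    where
      open ≡-Reasoning
      d = i ! * ((k ∸ i) ! * (n ∸ k) !)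
      instance _ = m*n≢0 (i !) ((k ∸ i) ! * (n ∸ k) !) {{i !≢0}} {{(k ∸ i) !* (n ∸ k) !≢0}}

  nCk*kCi≡nCi*[n∸i]C[n∸k] : ∀ {n k} i → k ≤ n → (n C k) * (k C i) ≡ (n C i) * ((n ∸ i) C (n ∸ k))
  nCk*kCi≡nCi*[n∸i]C[n∸k] {n} {k} i k≤n with i ≤? k
  ... | yes i≤k = begin
      (n C k) * (k C i)                       ≡⟨ nCk*kCi≡nCi*[n∸i]C[k∸i] i≤k k≤n ⟩
      (n C i) * ((n ∸ i) C (k ∸ i))           ≡⟨ cong ((n C i) *_) (nCk≡nC[n∸k] (∸-monoˡ-≤ i k≤n)) ⟩
      (n C i) * ((n ∸ i) C (n ∸ i ∸ (k ∸ i))) ≡⟨ cong (λ x → (n C i) * ((n ∸ i) C x)) (m∸o∸[n∸o]≡m∸n n i≤k) ⟩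
      (n C i) * ((n ∸ i) C (n ∸ k))           ∎
    where open ≡-Reasoning
  ... | no i≰k = begin
      (n C k) * (k C i)               ≡⟨ cong ((n C k) *_) (k>n⇒nCk≡0 k<i) ⟩
      (n C k) * 0                     ≡⟨ *-zeroʳ (n C k) ⟩
      0                               ≡⟨ rhs≡0 ⟨
      (n C i) * ((n ∸ i) C (n ∸ k))   ∎
    where
      open ≡-Reasoning
      k<i = ≰⇒> i≰k
      rhs≡0 : (n C i) * ((n ∸ i) C (n ∸ k)) ≡ 0
      rhs≡0 with i ≤? n
      ... | yes i≤n = trans (cong ((n C i) *_) (k>n⇒nCk≡0 (∸-monoʳ-< k<i i≤n))) (*-zeroʳ (n C i))
      ... | no  i≰n = cong (_* ((n ∸ i) C (n ∸ k))) (k>n⇒nCk≡0 (≰⇒> i≰n))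

  [n+k]Cn*[2n+k]Cn≡[2n+k]Ck*[2n]Cn : ∀ n k → ((n + k) C n) * ((2 * n + k) C n) ≡ ((2 * n + k) C k) * ((2 * n) C n)
  [n+k]Cn*[2n+k]Cn≡[2n+k]Ck*[2n]Cn n k = begin
      ((n + k) C n) * (N C n)             ≡⟨ cong₂ _*_ ([m+n]Cm≡[m+n]Cn n k) NCn≡NC[n+k] ⟩
      ((n + k) C k) * (N C (n + k))       ≡⟨ *-comm ((n + k) C k) (N C (n + k)) ⟩
      (N C (n + k)) * ((n + k) C k)       ≡⟨ nCk*kCi≡nCi*[n∸i]C[k∸i] (m≤n+m k n) (+-monoˡ-≤ k (m≤m+n n (n + 0))) ⟩
      (N C k) * ((N ∸ k) C (n + k ∸ k))   ≡⟨ cong₂ (λ a b → (N C k) * (a C b)) (m+n∸n≡m (2 * n) k) (m+n∸n≡m n k) ⟩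
      (N C k) * ((2 * n) C n)             ∎
    where
      open ≡-Reasoning
      N = 2 * n + k
      NCn≡NC[n+k] : N C n ≡ N C (n + k)
      NCn≡NC[n+k] = subst (λ m → m C n ≡ m C (n + k))
                          (solve 2 (λ n k → n :+ (n :+ k) := con 2 :* n :+ k) refl n k)
                          ([m+n]Cm≡[m+n]Cn n (n + k))

  [n+k]Cn*kCj≡[n+k]C[n+j]*[n+j]Cj : ∀ n k j → ((n + k) C n) * (k C j) ≡ ((n + k) C (n + j)) * ((n + j) C j)
  [n+k]Cn*kCj≡[n+k]C[n+j]*[n+j]Cj n k j with j ≤? k
  ... | yes j≤k = begin
      ((n + k) C n) * (k C j)                     ≡⟨ cong (_* (k C j)) ([m+n]Cm≡[m+n]Cn n k) ⟩
      ((n + k) C k) * (k C j)                     ≡⟨ nCk*kCi≡nCi*[n∸i]C[k∸i] j≤k (m≤n+m k n) ⟩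
      ((n + k) C j) * ((n + k ∸ j) C (k ∸ j))     ≡⟨ cong (((n + k) C j) *_) middle ⟩
      ((n + k) C j) * ((n + k ∸ j) C (n + j ∸ j)) ≡⟨ nCk*kCi≡nCi*[n∸i]C[k∸i] (m≤n+m j n) (+-monoʳ-≤ n j≤k) ⟨
      ((n + k) C (n + j)) * ((n + j) C j)         ∎
    where
      open ≡-Reasoning
      middle : (n + k ∸ j) C (k ∸ j) ≡ (n + k ∸ j) C (n + j ∸ j)
      middle = begin
        (n + k ∸ j) C (k ∸ j)       ≡⟨ cong (_C (k ∸ j)) (+-∸-assoc n j≤k) ⟩
        (n + (k ∸ j)) C (k ∸ j)     ≡⟨ [m+n]Cm≡[m+n]Cn n (k ∸ j) ⟨
        (n + (k ∸ j)) C n           ≡⟨ cong₂ _C_ (+-∸-assoc n j≤k) (m+n∸n≡m n j) ⟨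
        (n + k ∸ j) C (n + j ∸ j)   ∎
  ... | no j≰k = begin
      ((n + k) C n) * (k C j)                     ≡⟨ cong (((n + k) C n) *_) (k>n⇒nCk≡0 (≰⇒> j≰k)) ⟩
      ((n + k) C n) * 0                           ≡⟨ *-zeroʳ ((n + k) C n) ⟩
      0                                           ≡⟨ cong (_* ((n + j) C j)) (k>n⇒nCk≡0 (+-monoʳ-< n (≰⇒> j≰k))) ⟨
      ((n + k) C (n + j)) * ((n + j) C j)         ∎
    where open ≡-Reasoning

open import Defs
import Data.Nat
open import Data.Nat as ℕ using (ℕ; zero; suc; _≤_; _<_; _∸_; z≤n; s≤s)
import Data.Nat.Properties as ℕ
open import Data.Nat.Combinatorics using (_C_; nCk≡nC[n∸k]; k>n⇒nCk≡0; nCk+nC[k+1]≡[n+1]C[k+1])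
open import Data.Integer using (ℤ; +_; _+_; _*_; -_)
open import Data.Integer.Properties
open import Data.Integer.Solver using (module +-*-Solver)
open import Data.Product using (_×_; _,_)
open import Function using (_∘_)
open import Relation.Binary.PropositionalEquality
open import Relation.Nullary using (yes; no)
open +-*-Solver
open Binomial

sumTo-cong : ∀ n {f g : ℕ → ℤ} → (∀ k → k ≤ n → f k ≡ g k) → sumTo n f ≡ sumTo n g
sumTo-cong zero    f≗g = f≗g 0 z≤n
sumTo-cong (suc n) f≗g =
  cong₂ _+_ (sumTo-cong n (λ k k≤n → f≗g k (ℕ.m≤n⇒m≤1+n k≤n))) (f≗g (suc n) ℕ.≤-refl)

sumTo-distrib-+ : ∀ n (f g : ℕ → ℤ) → sumTo n (λ k → f k + g k) ≡ sumTo n f + sumTo n g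
sumTo-distrib-+ zero    f g = refl
sumTo-distrib-+ (suc n) f g = begin
    sumTo n (λ k → f k + g k) + (f (suc n) + g (suc n))   ≡⟨ cong (_+ (f (suc n) + g (suc n))) (sumTo-distrib-+ n f g) ⟩
    (sumTo n f + sumTo n g) + (f (suc n) + g (suc n))     ≡⟨ solve 4 (λ a b c d → (a :+ b) :+ (c :+ d) := (a :+ c) :+ (b :+ d))
                                                                     refl (sumTo n f) (sumTo n g) (f (suc n)) (g (suc n)) ⟩
    (sumTo n f + f (suc n)) + (sumTo n g + g (suc n))     ∎
  where open ≡-Reasoning

*-distribˡ-sumTo : ∀ n c (f : ℕ → ℤ) → c * sumTo n f ≡ sumTo n (λ k → c * f k)
*-distribˡ-sumTo zero    c f = refl
*-distribˡ-sumTo (suc n) c f =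
  trans (*-distribˡ-+ c (sumTo n f) (f (suc n))) (cong (_+ c * f (suc n)) (*-distribˡ-sumTo n c f))

sumTo-suc : ∀ n (f : ℕ → ℤ) → sumTo (suc n) f ≡ f 0 + sumTo n (f ∘ suc)
sumTo-suc zero    f = refl
sumTo-suc (suc n) f = trans (cong (_+ f (suc (suc n))) (sumTo-suc n f)) (+-assoc (f 0) _ _)

sumTo-extend : ∀ {n m} (f : ℕ → ℤ) → n ≤ m → (∀ k → n < k → f k ≡ + 0) → sumTo m f ≡ sumTo n f
sumTo-extend {m = zero}  f z≤n   _      = refl
sumTo-extend {n} {suc m} f n≤1+m f>n≡0 with n ℕ.≤? m
... | yes n≤m = trans (cong₂ _+_ (sumTo-extend f n≤m f>n≡0) (f>n≡0 (suc m) (s≤s n≤m))) (+-identityʳ _)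
... | no  n≰m = cong (λ k → sumTo k f) (ℕ.≤-antisym (ℕ.≰⇒> n≰m) n≤1+m)

sumTo-comm : ∀ n m (g : ℕ → ℕ → ℤ) → sumTo n (λ i → sumTo m (g i)) ≡ sumTo m (λ k → sumTo n (λ i → g i k))
sumTo-comm zero    m g = refl
sumTo-comm (suc n) m g = trans (cong (_+ sumTo m (g (suc n))) (sumTo-comm n m g))
                               (sym (sumTo-distrib-+ m (λ k → sumTo n (λ i → g i k)) (g (suc n))))

sumTo-reverse : ∀ n (f : ℕ → ℤ) → sumTo n f ≡ sumTo n (λ i → f (n ∸ i))
sumTo-reverse zero    f = refl
sumTo-reverse (suc n) f = begin
    sumTo n f + f (suc n)                    ≡⟨ cong (_+ f (suc n)) (sumTo-reverse n f) ⟩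
    sumTo n (λ i → f (n ∸ i)) + f (suc n)    ≡⟨ +-comm _ (f (suc n)) ⟩
    f (suc n) + sumTo n (λ i → f (n ∸ i))    ≡⟨ sumTo-suc n (λ i → f (suc n ∸ i)) ⟨
    sumTo (suc n) (λ i → f (suc n ∸ i))      ∎
  where open ≡-Reasoning

pascal-sumTo : ∀ a c (f : ℕ → ℤ) →
               sumTo (suc c) (λ i → + (suc a C i) * f i)
                 ≡ sumTo (suc c) (λ i → + (a C i) * f i) + sumTo c (λ i → + (a C i) * f (suc i))
pascal-sumTo a c f = begin
    sumTo (suc c) (λ i → + (suc a C i) * f i)                               ≡⟨ sumTo-suc c _ ⟩
    f₀ + sumTo c (λ i → + (suc a C suc i) * f (suc i))                      ≡⟨ cong (λ x → f₀ + x) (sumTo-cong c (λ i _ → pascal i)) ⟩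
    f₀ + sumTo c (λ i → + (a C i) * f (suc i) + + (a C suc i) * f (suc i))  ≡⟨ cong (λ x → f₀ + x) (sumTo-distrib-+ c _ _) ⟩
    f₀ + (S + S′)                                                           ≡⟨ solve 3 (λ x y z → x :+ (y :+ z) := (x :+ z) :+ y) refl f₀ S S′ ⟩
    (f₀ + S′) + S                                                           ≡⟨ cong (_+ S) (sumTo-suc c _) ⟨
    sumTo (suc c) (λ i → + (a C i) * f i) + S                               ∎
  where
    open ≡-Reasoning
    f₀ = + 1 * f 0
    S  = sumTo c (λ i → + (a C i) * f (suc i))
    S′ = sumTo c (λ i → + (a C suc i) * f (suc i))
    pascal : ∀ i → + (suc a C suc i) * f (suc i) ≡ + (a C i) * f (suc i) + + (a C suc i) * f (suc i)
    pascal i = begin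
      + (suc a C suc i) * f (suc i)                      ≡⟨ cong (λ x → + x * f (suc i)) (nCk+nC[k+1]≡[n+1]C[k+1] a i) ⟨
      + (a C i ℕ.+ a C suc i) * f (suc i)                ≡⟨ cong (_* f (suc i)) (pos-+ (a C i) (a C suc i)) ⟩
      (+ (a C i) + + (a C suc i)) * f (suc i)            ≡⟨ *-distribʳ-+ (f (suc i)) (+ (a C i)) (+ (a C suc i)) ⟩
      + (a C i) * f (suc i) + + (a C suc i) * f (suc i)  ∎

vandermonde : ∀ a b c → sumTo c (λ i → + (a C i) * + (b C (c ∸ i))) ≡ + ((a ℕ.+ b) C c)
vandermonde zero    b c = trans (sumTo-extend {m = c} _ z≤n 0Ck≡0) (*-identityˡ (+ (b C c)))
  where
    0Ck≡0 : ∀ k → 0 < k → + (0 C k) * + (b C (c ∸ k)) ≡ + 0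
    0Ck≡0 k 0<k = cong (λ x → + x * + (b C (c ∸ k))) (k>n⇒nCk≡0 0<k)
vandermonde (suc a) b zero    = refl
vandermonde (suc a) b (suc c) = begin
    sumTo (suc c) (λ i → + (suc a C i) * + (b C (suc c ∸ i)))
      ≡⟨ pascal-sumTo a c _ ⟩
    sumTo (suc c) (λ i → + (a C i) * + (b C (suc c ∸ i))) + sumTo c (λ i → + (a C i) * + (b C (c ∸ i)))
      ≡⟨ cong₂ _+_ (vandermonde a b (suc c)) (vandermonde a b c) ⟩
    + ((a ℕ.+ b) C suc c) + + ((a ℕ.+ b) C c)
      ≡⟨ +-comm (+ ((a ℕ.+ b) C suc c)) (+ ((a ℕ.+ b) C c)) ⟩
    + ((a ℕ.+ b) C c) + + ((a ℕ.+ b) C suc c)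
      ≡⟨ pos-+ ((a ℕ.+ b) C c) ((a ℕ.+ b) C suc c) ⟨
    + ((a ℕ.+ b) C c ℕ.+ (a ℕ.+ b) C suc c)
      ≡⟨ cong +_ (nCk+nC[k+1]≡[n+1]C[k+1] (a ℕ.+ b) c) ⟩
    + ((suc a ℕ.+ b) C suc c)
      ∎
  where open ≡-Reasoning

[a+k]Ck≡sumTo-aCi*kCi : ∀ a {k N} → k ≤ N → + ((a ℕ.+ k) C k) ≡ sumTo N (λ i → + (a C i) * + (k C i))
[a+k]Ck≡sumTo-aCi*kCi a {k} {N} k≤N = begin
    + ((a ℕ.+ k) C k)                            ≡⟨ vandermonde a k k ⟨
    sumTo k (λ i → + (a C i) * + (k C (k ∸ i)))  ≡⟨ sumTo-cong k (λ i i≤k → cong (λ x → + (a C i) * + x) (nCk≡nC[n∸k] i≤k)) ⟨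
    sumTo k (λ i → + (a C i) * + (k C i))        ≡⟨ sumTo-extend _ k≤N kCi≡0 ⟨
    sumTo N (λ i → + (a C i) * + (k C i))        ∎
  where
    open ≡-Reasoning
    kCi≡0 : ∀ i → k < i → + (a C i) * + (k C i) ≡ + 0
    kCi≡0 i k<i = trans (cong (λ x → + (a C i) * + x) (k>n⇒nCk≡0 k<i)) (*-zeroʳ (+ (a C i)))

sign-suc : ∀ m → sign (suc m) ≡ - sign m
sign-suc zero          = refl
sign-suc (suc zero)    = refl
sign-suc (suc (suc m)) = sign-suc m

alternating-binomial-sum : ∀ n s j →
                           sumTo n (λ k → + (n C k) * (sign (n ℕ.+ k) * + ((s ℕ.+ k) C (n ℕ.+ j)))) ≡ + (s C j)
alternating-binomial-sum zero    s j = begin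
    + 1 * (+ 1 * + ((s ℕ.+ 0) C j))  ≡⟨ trans (*-identityˡ _) (*-identityˡ _) ⟩
    + ((s ℕ.+ 0) C j)                ≡⟨ cong (λ x → + (x C j)) (ℕ.+-identityʳ s) ⟩
    + (s C j)                        ∎
  where open ≡-Reasoning
alternating-binomial-sum (suc n) s j = begin
    sumTo (suc n) (λ k → + (suc n C k) * g k)
      ≡⟨ pascal-sumTo n n g ⟩
    sumTo (suc n) (λ k → + (n C k) * g k) + sumTo n (λ k → + (n C k) * g (suc k))
      ≡⟨ cong (_+ sumTo n (λ k → + (n C k) * g (suc k))) top≡0 ⟩
    sumTo n (λ k → + (n C k) * g k) + sumTo n (λ k → + (n C k) * g (suc k))
      ≡⟨ sumTo-distrib-+ n _ _ ⟨
    sumTo n (λ k → + (n C k) * g k + + (n C k) * g (suc k))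
      ≡⟨ sumTo-cong n (λ k _ → trans (sym (*-distribˡ-+ (+ (n C k)) (g k) (g (suc k)))) (cong (+ (n C k) *_) (g-pascal k))) ⟩
    sumTo n (λ k → + (n C k) * (sign (n ℕ.+ k) * + ((s ℕ.+ k) C (n ℕ.+ j))))
      ≡⟨ alternating-binomial-sum n s j ⟩
    + (s C j)
      ∎
  where
    open ≡-Reasoning
    g : ℕ → ℤ
    g k = sign (suc n ℕ.+ k) * + ((s ℕ.+ k) C suc (n ℕ.+ j))
    top≡0 : sumTo (suc n) (λ k → + (n C k) * g k) ≡ sumTo n (λ k → + (n C k) * g k)
    top≡0 = trans (cong (λ x → sumTo n (λ k → + (n C k) * g k) + + x * g (suc n)) (k>n⇒nCk≡0 (ℕ.n<1+n n)))
                  (+-identityʳ _)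
    g-pascal : ∀ k → g k + g (suc k) ≡ sign (n ℕ.+ k) * + ((s ℕ.+ k) C (n ℕ.+ j))
    g-pascal k = begin
      sign (suc (n ℕ.+ k)) * + y + sign (suc n ℕ.+ suc k) * + ((s ℕ.+ suc k) C suc m)
        ≡⟨ cong₂ (λ σ τ → σ * + y + τ * + ((s ℕ.+ suc k) C suc m)) (sign-suc (n ℕ.+ k)) (cong (sign ∘ suc) (ℕ.+-suc n k)) ⟩
      - σ * + y + σ * + ((s ℕ.+ suc k) C suc m)
        ≡⟨ cong (λ z → - σ * + y + σ * + z) (trans (cong (_C suc m) (ℕ.+-suc s k)) (sym (nCk+nC[k+1]≡[n+1]C[k+1] (s ℕ.+ k) m))) ⟩
      - σ * + y + σ * + (x ℕ.+ y)
        ≡⟨ cong (λ z → - σ * + y + σ * z) (pos-+ x y) ⟩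
      - σ * + y + σ * (+ x + + y)
        ≡⟨ solve 3 (λ σ x y → :- σ :* y :+ σ :* (x :+ y) := σ :* x) refl σ (+ x) (+ y) ⟩
      σ * + x
        ∎
      where
        σ = sign (n ℕ.+ k)
        m = n ℕ.+ j
        x = (s ℕ.+ k) C m
        y = (s ℕ.+ k) C suc m

pos-*³ : ∀ a b c → + (a ℕ.* b ℕ.* c) ≡ + a * + b * + c
pos-*³ a b c = trans (pos-* (a ℕ.* b) c) (cong (_* + c) (pos-* a b))

pos-*-cong : ∀ a b c d → a ℕ.* b ≡ c ℕ.* d → + a * + b ≡ + c * + d
pos-*-cong a b c d eq = trans (sym (pos-* a b)) (trans (cong +_ eq) (pos-* c d))

module _ (n : ℕ) where

  squareTerm productTerm alternatingTerm : ℕ → ℤ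
  squareTerm      k = + ((n C k) ℕ.* (n C k) ℕ.* ((2 ℕ.* n ℕ.+ k) C n))
  productTerm     k = + ((n C k) ℕ.* ((n ℕ.+ k) C n) ℕ.* ((2 ℕ.* n) C k))
  alternatingTerm k = sign (n ℕ.+ k) * + ((n C k) ℕ.* ((n ℕ.+ k) C n) ℕ.* ((n ℕ.+ k) C n) ℕ.* ((2 ℕ.* n ℕ.+ k) C n))

  sumTo-productTerm≡sumTo-squareTerm : sumTo n productTerm ≡ sumTo n squareTerm
  sumTo-productTerm≡sumTo-squareTerm = begin
      sumTo n productTerm                      ≡⟨ sumTo-cong n expand ⟩
      sumTo n (λ k → sumTo n (λ i → g k i))    ≡⟨ sumTo-comm n n g ⟩
      sumTo n (λ i → sumTo n (λ k → g k i))    ≡⟨ sumTo-cong n (λ i _ → collapse i) ⟩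
      sumTo n h                                ≡⟨ sumTo-reverse n h ⟩
      sumTo n (λ i → h (n ∸ i))                ≡⟨ sumTo-cong n reflect ⟩
      sumTo n squareTerm                       ∎
    where
      open ≡-Reasoning
      m = 2 ℕ.* n
      g : ℕ → ℕ → ℤ
      g k i = (+ (m C k) * + (n C k)) * (+ (n C i) * + (k C i))
      h : ℕ → ℤ
      h i = + (n C i) * + (n C i) * + ((m ℕ.+ (n ∸ i)) C n)
      expand : ∀ k → k ≤ n → productTerm k ≡ sumTo n (g k)
      expand k k≤n = begin
        productTerm k
          ≡⟨ pos-*³ (n C k) ((n ℕ.+ k) C n) (m C k) ⟩
        + (n C k) * + ((n ℕ.+ k) C n) * + (m C k)
          ≡⟨ cong (λ x → + (n C k) * + x * + (m C k)) ([m+n]Cm≡[m+n]Cn n k) ⟩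
        + (n C k) * + ((n ℕ.+ k) C k) * + (m C k)
          ≡⟨ solve 3 (λ a b c → a :* b :* c := (c :* a) :* b) refl (+ (n C k)) _ (+ (m C k)) ⟩
        (+ (m C k) * + (n C k)) * + ((n ℕ.+ k) C k)
          ≡⟨ cong (λ x → + (m C k) * + (n C k) * x) ([a+k]Ck≡sumTo-aCi*kCi n k≤n) ⟩
        (+ (m C k) * + (n C k)) * sumTo n (λ i → + (n C i) * + (k C i))
          ≡⟨ *-distribˡ-sumTo n (+ (m C k) * + (n C k)) _ ⟩
        sumTo n (g k)
          ∎
      collapse : ∀ i → sumTo n (λ k → g k i) ≡ h i
      collapse i = begin
        sumTo n (λ k → g k i)
          ≡⟨ sumTo-cong n regroup ⟩
        sumTo n (λ k → + (n C i) * + (n C i) * (+ (m C k) * + ((n ∸ i) C (n ∸ k))))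
          ≡⟨ *-distribˡ-sumTo n (+ (n C i) * + (n C i)) _ ⟨
        + (n C i) * + (n C i) * sumTo n (λ k → + (m C k) * + ((n ∸ i) C (n ∸ k)))
          ≡⟨ cong (λ x → + (n C i) * + (n C i) * x) (vandermonde m (n ∸ i) n) ⟩
        h i
          ∎
        where
          regroup : ∀ k → k ≤ n → g k i ≡ + (n C i) * + (n C i) * (+ (m C k) * + ((n ∸ i) C (n ∸ k)))
          regroup k k≤n = begin
            (+ (m C k) * + (n C k)) * (+ (n C i) * + (k C i))
              ≡⟨ solve 4 (λ p a b d → (p :* a) :* (b :* d) := p :* b :* (a :* d)) refl (+ (m C k)) (+ (n C k)) (+ (n C i)) (+ (k C i)) ⟩
            + (m C k) * + (n C i) * (+ (n C k) * + (k C i))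
              ≡⟨ cong (λ x → + (m C k) * + (n C i) * x)
                      (pos-*-cong (n C k) (k C i) (n C i) ((n ∸ i) C (n ∸ k)) (nCk*kCi≡nCi*[n∸i]C[n∸k] i k≤n)) ⟩
            + (m C k) * + (n C i) * (+ (n C i) * + ((n ∸ i) C (n ∸ k)))
              ≡⟨ solve 3 (λ p b e → p :* b :* (b :* e) := b :* b :* (p :* e)) refl (+ (m C k)) (+ (n C i)) (+ ((n ∸ i) C (n ∸ k))) ⟩
            + (n C i) * + (n C i) * (+ (m C k) * + ((n ∸ i) C (n ∸ k)))
              ∎
      reflect : ∀ i → i ≤ n → h (n ∸ i) ≡ squareTerm i
      reflect i i≤n = begin
        h (n ∸ i)                                  ≡⟨ cong₂ (λ a b → + a * + a * + ((m ℕ.+ b) C n))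
                                                            (nCk≡nC[n∸k] i≤n) (sym (ℕ.m∸[m∸n]≡n i≤n)) ⟨
        + (n C i) * + (n C i) * + ((m ℕ.+ i) C n)  ≡⟨ pos-*³ (n C i) (n C i) ((m ℕ.+ i) C n) ⟨
        squareTerm i                               ∎

  sumTo-alternatingTerm≡[2n]Cn*sumTo-productTerm : sumTo n alternatingTerm ≡ + ((2 ℕ.* n) C n) * sumTo n productTerm
  sumTo-alternatingTerm≡[2n]Cn*sumTo-productTerm = begin
      sumTo n alternatingTerm    ≡⟨ sumTo-cong n (λ k _ → factor k) ⟩
      sumTo n (λ k → c * r k)    ≡⟨ *-distribˡ-sumTo n c r ⟨
      c * sumTo n r              ≡⟨ cong (c *_) sumTo-r≡sumTo-productTerm ⟩
      c * sumTo n productTerm    ∎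
    where
      open ≡-Reasoning
      m = 2 ℕ.* n
      c = + (m C n)
      r : ℕ → ℤ
      r k = + (n C k) * (sign (n ℕ.+ k) * + ((n ℕ.+ k) C n)) * + ((m ℕ.+ k) C k)
      factor : ∀ k → alternatingTerm k ≡ c * r k
      factor k = begin
        σ * + (a ℕ.* b ℕ.* b ℕ.* d)
          ≡⟨ cong (σ *_) (trans (pos-*³ (a ℕ.* b) b d) (cong (λ x → x * + b * + d) (pos-* a b))) ⟩
        σ * (+ a * + b * + b * + d)
          ≡⟨ solve 4 (λ σ a b d → σ :* (a :* b :* b :* d) := σ :* a :* b :* (b :* d)) refl σ (+ a) (+ b) (+ d) ⟩
        σ * + a * + b * (+ b * + d)
          ≡⟨ cong (λ x → σ * + a * + b * x) (pos-*-cong b d e (m C n) ([n+k]Cn*[2n+k]Cn≡[2n+k]Ck*[2n]Cn n k)) ⟩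
        σ * + a * + b * (+ e * c)
          ≡⟨ solve 5 (λ σ a b e c → σ :* a :* b :* (e :* c) := c :* (a :* (σ :* b) :* e)) refl σ (+ a) (+ b) (+ e) c ⟩
        c * (+ a * (σ * + b) * + e)
          ∎
        where
          σ = sign (n ℕ.+ k)
          a = n C k
          b = (n ℕ.+ k) C n
          d = (m ℕ.+ k) C n
          e = (m ℕ.+ k) C k
      sumTo-r≡sumTo-productTerm : sumTo n r ≡ sumTo n productTerm
      sumTo-r≡sumTo-productTerm = begin
        sumTo n r                                ≡⟨ sumTo-cong n expand ⟩
        sumTo n (λ k → sumTo n (q k))            ≡⟨ sumTo-comm n n q ⟩
        sumTo n (λ j → sumTo n (λ k → q k j))    ≡⟨ sumTo-cong n (λ j _ → collapse j) ⟩
        sumTo n productTerm                      ∎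
        where
          q : ℕ → ℕ → ℤ
          q k j = (+ (n C k) * (sign (n ℕ.+ k) * + ((n ℕ.+ k) C n))) * (+ (m C j) * + (k C j))
          expand : ∀ k → k ≤ n → r k ≡ sumTo n (q k)
          expand k k≤n = trans (cong (λ x → + (n C k) * (sign (n ℕ.+ k) * + ((n ℕ.+ k) C n)) * x) ([a+k]Ck≡sumTo-aCi*kCi m k≤n))
                               (*-distribˡ-sumTo n (+ (n C k) * (sign (n ℕ.+ k) * + ((n ℕ.+ k) C n))) _)
          regroup : ∀ j k → q k j ≡ (+ (m C j) * + ((n ℕ.+ j) C j)) * (+ (n C k) * (sign (n ℕ.+ k) * + ((n ℕ.+ k) C (n ℕ.+ j))))
          regroup j k = begin
            (+ a * (σ * + b)) * (+ c′ * + d)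
              ≡⟨ solve 5 (λ a σ b c d → (a :* (σ :* b)) :* (c :* d) := σ :* a :* c :* (b :* d)) refl (+ a) σ (+ b) (+ c′) (+ d) ⟩
            σ * + a * + c′ * (+ b * + d)
              ≡⟨ cong (λ x → σ * + a * + c′ * x) (pos-*-cong b d e f ([n+k]Cn*kCj≡[n+k]C[n+j]*[n+j]Cj n k j)) ⟩
            σ * + a * + c′ * (+ e * + f)
              ≡⟨ solve 5 (λ σ a c e f → σ :* a :* c :* (e :* f) := (c :* f) :* (a :* (σ :* e))) refl σ (+ a) (+ c′) (+ e) (+ f) ⟩
            (+ c′ * + f) * (+ a * (σ * + e))
              ∎
            where
              σ  = sign (n ℕ.+ k)
              a  = n C k
              b  = (n ℕ.+ k) C n
              c′ = m C j
              d  = k C j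
              e  = (n ℕ.+ k) C (n ℕ.+ j)
              f  = (n ℕ.+ j) C j
          collapse : ∀ j → sumTo n (λ k → q k j) ≡ productTerm j
          collapse j = begin
            sumTo n (λ k → q k j)
              ≡⟨ sumTo-cong n (λ k _ → regroup j k) ⟩
            sumTo n (λ k → P * (+ (n C k) * (sign (n ℕ.+ k) * + ((n ℕ.+ k) C (n ℕ.+ j)))))
              ≡⟨ *-distribˡ-sumTo n P _ ⟨
            P * sumTo n (λ k → + (n C k) * (sign (n ℕ.+ k) * + ((n ℕ.+ k) C (n ℕ.+ j))))
              ≡⟨ cong (P *_) (alternating-binomial-sum n n j) ⟩
            P * + (n C j)
              ≡⟨ cong (λ x → + (m C j) * + x * + (n C j)) ([m+n]Cm≡[m+n]Cn n j) ⟨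
            + (m C j) * + ((n ℕ.+ j) C n) * + (n C j)
              ≡⟨ solve 3 (λ c b a → c :* b :* a := a :* b :* c) refl (+ (m C j)) (+ ((n ℕ.+ j) C n)) (+ (n C j)) ⟩
            + (n C j) * + ((n ℕ.+ j) C n) * + (m C j)
              ≡⟨ pos-*³ (n C j) ((n ℕ.+ j) C n) (m C j) ⟨
            productTerm j
              ∎
            where
              P = + (m C j) * + ((n ℕ.+ j) C j)

mainTheorem17 : (n : ℕ) →
    ((+ ((2 Data.Nat.* n) C n)) * (+ ((2 Data.Nat.* n) C n)) * sumTo n (λ k → + ((n C k) Data.Nat.* (n C k) Data.Nat.* ((2 Data.Nat.* n Data.Nat.+ k) C n)))
      ≡ (+ ((2 Data.Nat.* n) C n)) * (+ ((2 Data.Nat.* n) C n)) * sumTo n (λ k → + ((n C k) Data.Nat.* ((n Data.Nat.+ k) C n) Data.Nat.* ((2 Data.Nat.* n) C k))))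
    × ((+ ((2 Data.Nat.* n) C n)) * (+ ((2 Data.Nat.* n) C n)) * sumTo n (λ k → + ((n C k) Data.Nat.* ((n Data.Nat.+ k) C n) Data.Nat.* ((2 Data.Nat.* n) C k)))
      ≡ (+ ((2 Data.Nat.* n) C n)) * sumTo n (λ k → sign (n Data.Nat.+ k) * + ((n C k) Data.Nat.* ((n Data.Nat.+ k) C n) Data.Nat.* ((n Data.Nat.+ k) C n) Data.Nat.* ((2 Data.Nat.* n Data.Nat.+ k) C n))))
mainTheorem17 n =
    cong (λ s → c * c * s) (sym (sumTo-productTerm≡sumTo-squareTerm n))
  , (begin
      c * c * sumTo n (productTerm n)      ≡⟨ *-assoc c c _ ⟩
      c * (c * sumTo n (productTerm n))    ≡⟨ cong (c *_) (sumTo-alternatingTerm≡[2n]Cn*sumTo-productTerm n) ⟨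
      c * sumTo n (alternatingTerm n)      ∎)
  where
    open ≡-Reasoning
    c = + ((2 ℕ.* n) C n)
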